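{- For every $u\in A^*\setminus A$, \[\sum_{v\in A}\mathrm{contr}(u,v)-2\,\mathrm{charge}(u,n_1(u))\geq(1-2\delta)\cdot w(\mathrm{supp}(u)).\]
   Context: Let $k\geq 3$ be an integer and $G=(V,E)$ a finite simple $(k+1)$-claw free graph (no vertex has $k+1$ pairwise non-adjacent neighbors) with weights $w:V\to\mathbb{Q}_{>0}$; $w(X)=\sum_{x\in X}w(x)$, $w^2(X)=\sum_{x\in X}w(x)^2$. Let $A^*$ be a maximum-weight independent set and $A$ an independent set. $N(X,A)=(X\cap A)\cup\{a\in A:a\text{ adjacent to some }x\in X\}$, $N(u,A)=N(\{u\},A)$. An independent $X$ is a local improvement if $w^2(X)>w^2(N(X,A))$; it is claw-shaped if $|X|=1$ and $N(X,A)=\emptyset$, or some $v\in A$ is adjacent to all of $X$. Assume no claw-shaped improvement of $A$ exists. Fix $\sigma\in(0,1)$ and set $\delta=\sigma/4$, $\alpha=\delta^{ -2}$, $\beta=\delta$, $m=\lceil\delta^{ -3}\rceil$. For $u\in V$ order $N(u,A)$ by non-increasing weight (ties fixed arbitrarily) and let $n_i(u)$ be its $i$-th element ($1\leq i\leq|N(u,A)|$). $\mathrm{contr}(u,v)=\max\{0,(w(u)^2-w^2(N(u,A)\setminus\{v\}))/w(v)\}$ if $v\in N(u,A)$, else $0$; $\mathrm{charge}(u,v)=w(u)-\frac12w(N(u,A))$ if $v=n_1(u)$, else $0$. For $u\in V\setminus A$ let $i^u_{end}=\min\{|N(u,A)|+1,\,m+1,\,\min\{i\leq|N(u,A)|: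 w(n_i(u))\notin[\alpha^{ -1}w(u),\alpha w(u)]\}\}$ (with $\min\emptyset=\infty$); $\mathrm{help}(u)=\{n_i(u):1\leq i<i^u_{end}\}$ if $w^2(\{n_i(u):i^u_{end}\leq i\leq|N(u,A)|\})\leq\beta w(u)^2$, and $\mathrm{help}(u)=\emptyset$ otherwise. $\mathrm{supp}(u)=N(u,A)\setminus\mathrm{help}(u)$. -}

module Defs where

open import Data.Bool using (Bool; true; false; _∧_; _∨_; not; if_then_else_)
open import Data.Nat as ℕ using (ℕ; zero; suc; _⊓_)
open import Data.Fin using (Fin; _≟_)
open import Data.Integer using (+_)
open import Data.Fin.Subset using (Subset; _∈_; _∉_; ⁅_⁆; ∣_∣; Empty; _∩_; ∁)
open import Data.Vec using (lookup; tabulate)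
open import Data.List using (List; []; _∷_; take; drop; map; foldr)
open import Data.List.Relation.Unary.Unique.Propositional using (Unique)
open import Data.List.Relation.Unary.Linked using (Linked)
import Data.List.Membership.Propositional as LMem
import Data.Integer as ℤ
open import Data.Rational using (ℚ; 0ℚ; _+_; _*_; _-_; _÷_; 1/_; _⊔_; _≤_; _<_; _≤ᵇ_; ½; Positive; ceiling; _/_)
open import Data.Rational.Properties using (pos⇒nonZero; pos*pos⇒pos; 1/pos⇒pos)
open import Data.Product using (_×_; ∃; Σ)
open import Data.Sum using (_⊎_)
open import Relation.Nullary using (¬_; does)
open import Relation.Binary.PropositionalEquality using (_≡_; _≢_)
open import Function.Bundles using (_⇔_)

Σᶠ : ∀ n → (Fin n → ℚ) → ℚ
Σᶠ zero    f = 0ℚ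
Σᶠ (suc n) f = f Fin.zero + Σᶠ n (λ i → f (Fin.suc i))
  where import Data.Fin as Fin

anyᶠ : ∀ n → (Fin n → Bool) → Bool
anyᶠ zero    f = false
anyᶠ (suc n) f = f Fin.zero ∨ anyᶠ n (λ i → f (Fin.suc i))
  where import Data.Fin as Fin

memB : ∀ {n} → Fin n → List (Fin n) → Bool
memB a []       = false
memB a (b ∷ bs) = does (a ≟ b) ∨ memB a bs

module Setting
  (n   : ℕ)
  (adj : Fin n → Fin n → Bool)
  (w   : Fin n → ℚ)
  (wpos : ∀ i → Positive (w i))
  (A   : Subset n)
  (σ   : ℚ) (σpos : Positive σ)
  (ord : Fin n → List (Fin n))         -- ord u = (n_1(u), n_2(u), ...)
  where

  Symmetric : Set
  Symmetric = ∀ x y → adj x y ≡ adj y x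

  Irreflexive : Set
  Irreflexive = ∀ x → adj x x ≡ false

  -- (k+1)-claw free: no vertex has k+1 pairwise non-adjacent (distinct) neighbours
  ClawFree : ℕ → Set
  ClawFree k = ∀ (v : Fin n) (f : Fin (suc k) → Fin n)
    → (∀ i → adj v (f i) ≡ true)
    → (∀ i j → f i ≡ f j → i ≡ j)
    → ¬ (∀ i j → i ≢ j → adj (f i) (f j) ≡ false)

  Independent : Subset n → Set
  Independent X = ∀ x y → x ∈ X → y ∈ X → adj x y ≡ false

  wt : Subset n → ℚ
  wt X = Σᶠ n (λ i → if lookup X i then w i else 0ℚ)

  wt2 : Subset n → ℚ
  wt2 X = Σᶠ n (λ i → if lookup X i then w i * w i else 0ℚ)

  NA : Subset n → Subset n
  NA X = tabulate (λ a → lookup A a ∧ (lookup X a ∨ anyᶠ n (λ x → lookup X x ∧ adj x a)))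

  Nu : Fin n → Subset n
  Nu u = NA ⁅ u ⁆

  LocalImprovement : Subset n → Set
  LocalImprovement X = Independent X × wt2 (NA X) < wt2 X

  ClawShaped : Subset n → Set
  ClawShaped X = (∣ X ∣ ≡ 1 × Empty (NA X))
               ⊎ ∃ (λ v → v ∈ A × (∀ x → x ∈ X → adj v x ≡ true))

  NoClawShapedImprovement : Set
  NoClawShapedImprovement = ∀ X → ClawShaped X → ¬ LocalImprovement X

  MaxWeightIndependent : Subset n → Set
  MaxWeightIndependent B = Independent B × (∀ I → Independent I → wt I ≤ wt B)

  ValidOrder : Set
  ValidOrder = ∀ u → Unique (ord u)
                   × (∀ a → (a LMem.∈ ord u) ⇔ (a ∈ Nu u))
                   × Linked (λ a b → w b ≤ w a) (ord u)

  δ : ℚ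
  δ = σ * (+ 1 / 4)

  private
    δpos : Positive δ
    δpos = pos*pos⇒pos σ {{σpos}} (+ 1 / 4)
    δ²pos : Positive (δ * δ)
    δ²pos = pos*pos⇒pos δ {{δpos}} δ {{δpos}}
    δ³pos : Positive (δ * δ * δ)
    δ³pos = pos*pos⇒pos (δ * δ) {{δ²pos}} δ {{δpos}}

  α : ℚ
  α = (1/ (δ * δ)) {{pos⇒nonZero (δ * δ) {{δ²pos}}}}

  private
    αpos : Positive α
    αpos = 1/pos⇒pos (δ * δ) {{δ²pos}}

  α⁻¹ : ℚ
  α⁻¹ = (1/ α) {{pos⇒nonZero α {{αpos}}}}

  β : ℚ
  β = δ

  m : ℕ
  m = ℤ.∣ ceiling ((1/ (δ * δ * δ)) {{pos⇒nonZero (δ * δ * δ) {{δ³pos}}}}) ∣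

  contr : Fin n → Fin n → ℚ
  contr u v = if lookup (Nu u) v
              then 0ℚ ⊔ ((w u * w u - wt2 (Nu u ∩ ∁ ⁅ v ⁆)) ÷ w v)
                         {{pos⇒nonZero (w v) {{wpos v}}}}
              else 0ℚ

  contrSum : Fin n → ℚ
  contrSum u = Σᶠ n (λ v → if lookup A v then contr u v else 0ℚ)

  charge : Fin n → Fin n → ℚ
  charge u v with ord u
  ... | []    = 0ℚ
  ... | a ∷ _ = if does (a ≟ v) then w u - ½ * wt (Nu u) else 0ℚ

  inRange : Fin n → Fin n → Bool
  inRange u a = (α⁻¹ * w u ≤ᵇ w a) ∧ (w a ≤ᵇ α * w u)

  prefixLen : Fin n → List (Fin n) → ℕ
  prefixLen u []       = 0
  prefixLen u (a ∷ as) = if inRange u a then suc (prefixLen u as) else 0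

  -- i^u_end − 1  (= min{|N(u,A)|, m, (first out-of-range index) − 1})
  iEnd-1 : Fin n → ℕ
  iEnd-1 u = prefixLen u (ord u) ⊓ m

  tailWt2 : Fin n → ℚ
  tailWt2 u = foldr _+_ 0ℚ (map (λ a → w a * w a) (drop (iEnd-1 u) (ord u)))

  help : Fin n → List (Fin n)
  help u = if tailWt2 u ≤ᵇ β * (w u * w u) then take (iEnd-1 u) (ord u) else []

  supp : Fin n → Subset n
  supp u = tabulate (λ a → lookup (Nu u) a ∧ not (memB a (help u)))

{-# OPTIONS --safe #-}
module Submission where

-- Write x = w(u), L = (n₁(u), n₂(u), …), S = w(help(u)) and P = w(supp(u)), so that
-- w(N(u,A)) = S + P and 2 charge(u, n₁(u)) = 2x − S − P; the claim then reads
-- 2x ≤ contr(u, n₁(u)) + S + 2δP.  Since {u} is claw-shaped, x² ≤ w²(N(u,A)), so L is nonempty.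
--  • If help(u) is empty because the tail condition fails, then x ≤ δP: either the first m
--    neighbours all lie in [δ²x, x/δ²], giving P ≥ mδ²x ≥ x/δ, or the first neighbour outside
--    that range is heavier than x/δ², or it is lighter than δ²x, and then so is the whole tail,
--    so δx² < w²(tail) ≤ δ²x·w(tail).
--  • If help(u) consists of the first m neighbours, then x ≤ δS ≤ S/2 in the same way.
--  • Otherwise help(u) is the maximal in-range prefix; it contains n₁(u), of weight w₁, since
--    otherwise w²(N(u,A)) ≤ δx² < x², and the tail consists of neighbours lighter than δ²x,
--    because they are lighter than w₁ ≤ x/δ².  Multiplying by w₁, the claim becomes
--    (x − w₁)² + 2δPw₁ − w²(supp) + (w₁S − w²(help)) ≥ 0: the sorting gives w²(help) ≤ w₁S, and
--    w²(supp) ≤ min(δx², δ²xP) is at most 2δPw₁ when x ≤ 2w₁ and at most (x − w₁)² otherwise.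

open import Defs
open import Data.Nat using (ℕ) renaming (_≤_ to _≤ℕ_)
open import Data.Bool using (Bool)
open import Data.Fin using (Fin)
open import Data.Fin.Subset using (Subset; _∈_; _∉_)
open import Data.List using (List; head)
open import Data.Maybe using (just)
open import Data.Rational using (ℚ; Positive; _<_; _≤_; _*_; _-_; _+_; 1ℚ)
open import Data.Product using (_×_; ∃)
open import Relation.Binary.PropositionalEquality using (_≡_)

open import Algebra using (CommutativeMonoid)
open import Data.Bool using (true; false; _∧_; _∨_; not; if_then_else_; T)
open import Data.Bool.Properties using (T-∧; T-≡; ∨-identityʳ; ∧-identityʳ)
open import Data.Empty using (⊥; ⊥-elim)
open import Data.Fin using (_≟_) renaming (zero to fzero; suc to fsuc)
open import Data.Fin.Subset using (⁅_⁆; _∩_; ∁) renaming (⊥ to ∅)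
open import Data.Fin.Subset.Properties using (∣⁅x⁆∣≡1; x∈⁅y⁆⇒x≡y)
import Data.Integer as ℤ
import Data.Integer.Properties as ℤ
open import Data.Integer.DivMod using ([n/d]*d≤n)
open import Data.List using ([]; _∷_; _++_; map; foldr; take; drop)
open import Data.List.Properties using (take++drop≡id)
open import Data.List.Relation.Unary.All as All using (All; []; _∷_)
import Data.List.Relation.Unary.All.Properties as All
open import Data.List.Relation.Unary.AllPairs using (AllPairs; []; _∷_)
import Data.List.Relation.Unary.AllPairs.Properties as AllPairs
open import Data.List.Relation.Unary.Any using (here; there)
open import Data.List.Relation.Unary.Linked.Properties using (Linked⇒AllPairs)
open import Data.List.Relation.Unary.Unique.Propositional using (Unique)
import Data.List.Relation.Unary.Unique.Propositional.Properties as Unique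
import Data.List.Membership.Propositional as List
open import Data.Nat using (zero; suc; _⊓_; z≤n; s≤s)
import Data.Nat.Properties as ℕ
open import Data.Product using (_,_; proj₁; proj₂)
open import Data.Rational using (0ℚ; ½; -_; _/_; NonZero; _⊔_; _÷_; 1/_; _≤ᵇ_; mkℚ; ceiling; toℚᵘ; nonNegative; positive)
open import Data.Rational.Properties hiding (_≟_)
import Data.Rational.Properties as ℚ using (_≟_)
import Data.Rational.Unnormalised as ℚᵘ
import Data.Rational.Unnormalised.Properties as ℚᵘ
open import Data.Sum as Sum using (_⊎_; inj₁; inj₂)
open import Data.Vec using (lookup)
open import Data.Vec.Properties using ([]=⇒lookup; lookup⇒[]=; lookup∘tabulate; lookup-zipWith; lookup-map)
open import Function using (_∘_)
open import Function.Bundles using (Equivalence; _⇔_)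
open import Level using (0ℓ)
open import Relation.Binary.PropositionalEquality using (_≢_; refl; sym; trans; cong; cong₂; subst; subst₂; module ≡-Reasoning)
open import Relation.Nullary using (¬_; Dec; does; yes; no)
open import Relation.Nullary.Decidable using (dec⇒maybe; dec-true)
open import Tactic.RingSolver using (solve-∀)
open import Tactic.RingSolver.Core.AlmostCommutativeRing using (AlmostCommutativeRing; fromCommutativeRing)
import Data.Integer.Tactic.RingSolver as ℤ
open import Algebra.Properties.CommutativeSemigroup (CommutativeMonoid.commutativeSemigroup +-0-commutativeMonoid) using (interchange)

-- Sums over Fin n and over lists

Σᶠ-cong : ∀ n {f g : Fin n → ℚ} → (∀ i → f i ≡ g i) → Σᶠ n f ≡ Σᶠ n g
Σᶠ-cong zero    eq = refl
Σᶠ-cong (suc n) eq = cong₂ _+_ (eq fzero) (Σᶠ-cong n (eq ∘ fsuc))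

Σᶠ-zero : ∀ n → Σᶠ n (λ _ → 0ℚ) ≡ 0ℚ
Σᶠ-zero zero    = refl
Σᶠ-zero (suc n) = trans (+-identityˡ _) (Σᶠ-zero n)

Σᶠ-+ : ∀ n (f g : Fin n → ℚ) → Σᶠ n (λ i → f i + g i) ≡ Σᶠ n f + Σᶠ n g
Σᶠ-+ zero    f g = refl
Σᶠ-+ (suc n) f g = trans (cong (f fzero + g fzero +_) (Σᶠ-+ n (f ∘ fsuc) (g ∘ fsuc)))
                         (interchange (f fzero) (g fzero) _ _)

Σᶠ-indicator : ∀ n (f : Fin n → ℚ) a → Σᶠ n (λ i → if does (i ≟ a) then f i else 0ℚ) ≡ f a
Σᶠ-indicator (suc n) f fzero    = trans (cong (f fzero +_) (Σᶠ-zero n)) (+-identityʳ _)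
Σᶠ-indicator (suc n) f (fsuc a) = trans (+-identityˡ _) (Σᶠ-indicator n (f ∘ fsuc) a)

Σᶠ-nonNeg : ∀ n (f : Fin n → ℚ) → (∀ i → 0ℚ ≤ f i) → 0ℚ ≤ Σᶠ n f
Σᶠ-nonNeg zero    f f≥0 = ≤-refl
Σᶠ-nonNeg (suc n) f f≥0 = +-mono-≤ (f≥0 fzero) (Σᶠ-nonNeg n (f ∘ fsuc) (f≥0 ∘ fsuc))

Σᶠ-term≤ : ∀ n (f : Fin n → ℚ) → (∀ i → 0ℚ ≤ f i) → ∀ a → f a ≤ Σᶠ n f
Σᶠ-term≤ (suc n) f f≥0 fzero = begin
  f fzero                         ≡⟨ +-identityʳ (f fzero) ⟨
  f fzero + 0ℚ                    ≤⟨ +-monoʳ-≤ (f fzero) (Σᶠ-nonNeg n (f ∘ fsuc) (f≥0 ∘ fsuc)) ⟩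
  f fzero + Σᶠ n (f ∘ fsuc)       ∎
  where open ≤-Reasoning
Σᶠ-term≤ (suc n) f f≥0 (fsuc a) = begin
  f (fsuc a)                      ≡⟨ +-identityˡ (f (fsuc a)) ⟨
  0ℚ + f (fsuc a)                 ≤⟨ +-mono-≤ (f≥0 fzero) (Σᶠ-term≤ n (f ∘ fsuc) (f≥0 ∘ fsuc) a) ⟩
  f fzero + Σᶠ n (f ∘ fsuc)       ∎
  where open ≤-Reasoning

Σˡ : {A : Set} → (A → ℚ) → List A → ℚ
Σˡ f xs = foldr _+_ 0ℚ (map f xs)

module _ {A : Set} (f : A → ℚ) where

  Σˡ-++ : ∀ xs ys → Σˡ f (xs ++ ys) ≡ Σˡ f xs + Σˡ f ys
  Σˡ-++ []       ys = sym (+-identityˡ _)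
  Σˡ-++ (x ∷ xs) ys = trans (cong (f x +_) (Σˡ-++ xs ys)) (sym (+-assoc (f x) (Σˡ f xs) (Σˡ f ys)))

  Σˡ-take-drop : ∀ k xs → Σˡ f xs ≡ Σˡ f (take k xs) + Σˡ f (drop k xs)
  Σˡ-take-drop k xs = trans (cong (Σˡ f) (sym (take++drop≡id k xs))) (Σˡ-++ (take k xs) (drop k xs))

  module _ (f≥0 : ∀ a → 0ℚ ≤ f a) where

    Σˡ-nonNeg : ∀ xs → 0ℚ ≤ Σˡ f xs
    Σˡ-nonNeg []       = ≤-refl
    Σˡ-nonNeg (x ∷ xs) = +-mono-≤ (f≥0 x) (Σˡ-nonNeg xs)

    Σˡ-take≤ : ∀ k xs → Σˡ f (take k xs) ≤ Σˡ f xs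
    Σˡ-take≤ k xs = begin
      Σˡ f (take k xs)                       ≡⟨ +-identityʳ _ ⟨
      Σˡ f (take k xs) + 0ℚ                  ≤⟨ +-monoʳ-≤ (Σˡ f (take k xs)) (Σˡ-nonNeg (drop k xs)) ⟩
      Σˡ f (take k xs) + Σˡ f (drop k xs)    ≡⟨ Σˡ-take-drop k xs ⟨
      Σˡ f xs                                ∎
      where open ≤-Reasoning

    Σˡ-drop≤ : ∀ k xs → Σˡ f (drop k xs) ≤ Σˡ f xs
    Σˡ-drop≤ k xs = begin
      Σˡ f (drop k xs)                       ≡⟨ +-identityˡ _ ⟨
      0ℚ + Σˡ f (drop k xs)                  ≤⟨ +-monoˡ-≤ (Σˡ f (drop k xs)) (Σˡ-nonNeg (take k xs)) ⟩
      Σˡ f (take k xs) + Σˡ f (drop k xs)    ≡⟨ Σˡ-take-drop k xs ⟨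
      Σˡ f xs                                ∎
      where open ≤-Reasoning

    Σˡ-head≤ : ∀ x xs → f x ≤ Σˡ f (x ∷ xs)
    Σˡ-head≤ x xs = begin
      f x                ≡⟨ +-identityʳ (f x) ⟨
      f x + 0ℚ           ≤⟨ +-monoʳ-≤ (f x) (Σˡ-nonNeg xs) ⟩
      f x + Σˡ f xs      ∎
      where open ≤-Reasoning

    Σˡ-squares≤ : ∀ {M} xs → All (λ a → f a ≤ M) xs → Σˡ (λ a → f a * f a) xs ≤ M * Σˡ f xs
    Σˡ-squares≤ {M} []       []         = ≤-reflexive (sym (*-zeroʳ M))
    Σˡ-squares≤ {M} (x ∷ xs) (fx≤M ∷ p) = begin
      f x * f x + Σˡ (λ a → f a * f a) xs  ≤⟨ +-mono-≤ (*-monoʳ-≤-nonNeg (f x) {{nonNegative (f≥0 x)}} fx≤M)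
                                                         (Σˡ-squares≤ xs p) ⟩
      M * f x + M * Σˡ f xs                ≡⟨ *-distribˡ-+ M (f x) (Σˡ f xs) ⟨
      M * (f x + Σˡ f xs)                  ∎
      where open ≤-Reasoning

-- Boolean membership in lists and subsets

memB⇒∈ : ∀ {n} {a : Fin n} xs → memB a xs ≡ true → a List.∈ xs
memB⇒∈ {a = a} (b ∷ xs) eq with a ≟ b
... | yes a≡b = here a≡b
... | no  _   = there (memB⇒∈ xs eq)

∈⇒memB : ∀ {n} {a : Fin n} {xs} → a List.∈ xs → memB a xs ≡ true
∈⇒memB {a = a} {b ∷ _} (here a≡b) with a ≟ b
... | yes _   = refl
... | no  a≢b = ⊥-elim (a≢b a≡b)
∈⇒memB {a = a} {b ∷ _} (there a∈xs) with a ≟ b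
... | yes _ = refl
... | no  _ = ∈⇒memB a∈xs

memB-∉ : ∀ {n} {a : Fin n} {xs} → All (a ≢_) xs → memB a xs ≡ false
memB-∉ []                  = refl
memB-∉ {a = a} {b ∷ _} (a≢b ∷ p) with a ≟ b
... | yes a≡b = ⊥-elim (a≢b a≡b)
... | no  _   = memB-∉ p

memB-++-∖ : ∀ {n} (a : Fin n) xs ys → Unique (xs ++ ys) → memB a (xs ++ ys) ∧ not (memB a xs) ≡ memB a ys
memB-++-∖ a []       ys _          = ∧-identityʳ (memB a ys)
memB-++-∖ a (x ∷ xs) ys (x∉ ∷ uniq) with a ≟ x
... | yes refl = sym (memB-∉ (All.++⁻ʳ xs x∉))
... | no  _    = memB-++-∖ a xs ys uniq

Σᶠ-memB : ∀ n (f : Fin n → ℚ) xs → Unique xs → Σᶠ n (λ i → if memB i xs then f i else 0ℚ) ≡ Σˡ f xs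
Σᶠ-memB n f []       _           = Σᶠ-zero n
Σᶠ-memB n f (x ∷ xs) (x∉ ∷ uniq) = begin
  Σᶠ n (λ i → if does (i ≟ x) ∨ memB i xs then f i else 0ℚ)
    ≡⟨ Σᶠ-cong n split ⟩
  Σᶠ n (λ i → (if does (i ≟ x) then f i else 0ℚ) + (if memB i xs then f i else 0ℚ))
    ≡⟨ Σᶠ-+ n _ _ ⟩
  Σᶠ n (λ i → if does (i ≟ x) then f i else 0ℚ) + Σᶠ n (λ i → if memB i xs then f i else 0ℚ)
    ≡⟨ cong₂ _+_ (Σᶠ-indicator n f x) (Σᶠ-memB n f xs uniq) ⟩
  f x + Σˡ f xs ∎
  where
  open ≡-Reasoning
  split : ∀ i → (if does (i ≟ x) ∨ memB i xs then f i else 0ℚ)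
              ≡ (if does (i ≟ x) then f i else 0ℚ) + (if memB i xs then f i else 0ℚ)
  split i with i ≟ x
  ... | yes refl rewrite memB-∉ x∉ = sym (+-identityʳ (f i))
  ... | no  _    = sym (+-identityˡ _)

Σᶠ-subset : ∀ n (f : Fin n → ℚ) (X : Subset n) xs → (∀ i → lookup X i ≡ memB i xs) → Unique xs →
            Σᶠ n (λ i → if lookup X i then f i else 0ℚ) ≡ Σˡ f xs
Σᶠ-subset n f X xs X≡xs uniq =
  trans (Σᶠ-cong n (λ i → cong (λ b → if b then f i else 0ℚ) (X≡xs i))) (Σᶠ-memB n f xs uniq)

lookup-⁅⁆ : ∀ {n} (v i : Fin n) → lookup ⁅ v ⁆ i ≡ does (i ≟ v)
lookup-⁅⁆ fzero    fzero    = refl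
lookup-⁅⁆ fzero    (fsuc i) = lookup-∅ i
  where
  lookup-∅ : ∀ {n} (i : Fin n) → lookup ∅ i ≡ false
  lookup-∅ fzero    = refl
  lookup-∅ (fsuc i) = lookup-∅ i
lookup-⁅⁆ (fsuc v) fzero    = refl
lookup-⁅⁆ (fsuc v) (fsuc i) = lookup-⁅⁆ v i

≡-from-true⇔true : ∀ {b c : Bool} → (b ≡ true → c ≡ true) → (c ≡ true → b ≡ true) → b ≡ c
≡-from-true⇔true {false} {false} _ _ = refl
≡-from-true⇔true {false} {true}  _ g = g refl
≡-from-true⇔true {true}  {false} f _ = sym (f refl)
≡-from-true⇔true {true}  {true}  _ _ = refl

∧-true⁻ : ∀ {b c} → b ∧ c ≡ true → b ≡ true × c ≡ true
∧-true⁻ {true} c≡true = refl , c≡true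

∨-true⁻ : ∀ {b c} → b ∨ c ≡ true → b ≡ true ⊎ c ≡ true
∨-true⁻ {true}  _      = inj₁ refl
∨-true⁻ {false} c≡true = inj₂ c≡true

anyᶠ-true⁻ : ∀ n (f : Fin n → Bool) → anyᶠ n f ≡ true → ∃ λ i → f i ≡ true
anyᶠ-true⁻ (suc n) f any≡true with ∨-true⁻ {f fzero} any≡true
... | inj₁ f0≡true   = fzero , f0≡true
... | inj₂ rest≡true with i , fi≡true ← anyᶠ-true⁻ n (f ∘ fsuc) rest≡true = fsuc i , fi≡true

Bool-elim : ∀ {ℓ} (P : Bool → Set ℓ) b → (b ≡ true → P true) → (b ≡ false → P false) → P b
Bool-elim P true  t _ = t refl
Bool-elim P false _ f = f refl

if-take : ∀ {A : Set} b k (xs : List A) → (if b then take k xs else []) ≡ take (if b then k else 0) xs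
if-take true  k xs = refl
if-take false k xs = refl

-- Inequalities between rationals

ring : AlmostCommutativeRing 0ℓ 0ℓ
ring = fromCommutativeRing +-*-commutativeRing (λ q → dec⇒maybe (0ℚ ℚ.≟ q))

≤-via-diff : ∀ {p q} e → q - p ≡ e → 0ℚ ≤ e → p ≤ q
≤-via-diff {p} {q} e q-p≡e 0≤e = begin
  p            ≡⟨ +-identityʳ p ⟨
  p + 0ℚ       ≤⟨ +-monoʳ-≤ p 0≤e ⟩
  p + e        ≡⟨ cong (p +_) q-p≡e ⟨
  p + (q - p)  ≡⟨ p+[q-p]≡q p q ⟩
  q            ∎
  where
  open ≤-Reasoning
  p+[q-p]≡q : ∀ p q → p + (q - p) ≡ q
  p+[q-p]≡q = solve-∀ ring

0≤q-p : ∀ {p q} → p ≤ q → 0ℚ ≤ q - p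
0≤q-p {p} {q} p≤q = begin
  0ℚ     ≡⟨ +-inverseʳ p ⟨
  p - p  ≤⟨ +-monoˡ-≤ (- p) p≤q ⟩
  q - p  ∎
  where open ≤-Reasoning

0≤* : ∀ {p q} → 0ℚ ≤ p → 0ℚ ≤ q → 0ℚ ≤ p * q
0≤* {p} {q} 0≤p 0≤q =
  nonNegative⁻¹ (p * q) {{nonNeg*nonNeg⇒nonNeg p {{nonNegative 0≤p}} q {{nonNegative 0≤q}}}}

0≤sq : ∀ p → 0ℚ ≤ p * p
0≤sq p with ≤-total 0ℚ p
... | inj₁ 0≤p = 0≤* 0≤p 0≤p
... | inj₂ p≤0 = subst (0ℚ ≤_) (-p*-p≡p*p p) (0≤* (neg-antimono-≤ p≤0) (neg-antimono-≤ p≤0))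
  where
  -p*-p≡p*p : ∀ p → - p * - p ≡ p * p
  -p*-p≡p*p = solve-∀ ring

≤ᵇ-∧-false : ∀ {p q r s} → (p ≤ᵇ q) ∧ (r ≤ᵇ s) ≡ false → q < p ⊎ s < r
≤ᵇ-∧-false {p} {q} {r} {s} conj≡false with p ≤? q
... | no  p≰q = inj₁ (≰⇒> p≰q)
... | yes p≤q = inj₂ (≰⇒> (λ r≤s → subst T conj≡false (Equivalence.from T-∧ (≤⇒≤ᵇ p≤q , ≤⇒≤ᵇ r≤s))))

0<sq : ∀ {p} → 0ℚ < p → 0ℚ < p * p
0<sq {p} 0<p = positive⁻¹ (p * p) {{pos*pos⇒pos p {{positive 0<p}} p {{positive 0<p}}}}

0≤if : ∀ b {p} → 0ℚ ≤ p → 0ℚ ≤ (if b then p else 0ℚ)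
0≤if true  0≤p = 0≤p
0≤if false _   = ≤-refl

0≤-of-four : ∀ p → 0ℚ ≤ p + p + p + p → 0ℚ ≤ p
0≤-of-four p 0≤4p = *-cancelʳ-≤-pos four (begin
  0ℚ * four        ≡⟨ *-zeroˡ four ⟩
  0ℚ               ≤⟨ 0≤4p ⟩
  p + p + p + p    ≡⟨ p*4 p ⟨
  p * four         ∎)
  where
  open ≤-Reasoning
  four = 1ℚ + 1ℚ + 1ℚ + 1ℚ
  p*4 : ∀ p → p * (1ℚ + 1ℚ + 1ℚ + 1ℚ) ≡ p + p + p + p
  p*4 = solve-∀ ring

δ≤1-of-four : ∀ {δ} → 0ℚ ≤ δ → δ + δ + δ + δ ≤ 1ℚ → δ ≤ 1ℚ
δ≤1-of-four {δ} 0≤δ 4δ≤1 = ≤-trans (≤-via-diff (δ + δ + δ) (diff δ) (+-mono-≤ (+-mono-≤ 0≤δ 0≤δ) 0≤δ)) 4δ≤1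
  where
  diff : ∀ δ → δ + δ + δ + δ - δ ≡ δ + δ + δ
  diff = solve-∀ ring

δ<1-of-four : ∀ {δ} → 0ℚ < δ → δ + δ + δ + δ ≤ 1ℚ → δ < 1ℚ
δ<1-of-four {δ} 0<δ 4δ≤1 = <-≤-trans (begin-strict
  δ                 ≡⟨ +-identityʳ δ ⟨
  δ + 0ℚ            <⟨ +-monoʳ-< δ (+-mono-< (+-mono-< 0<δ 0<δ) 0<δ) ⟩
  δ + (δ + δ + δ)   ≡⟨ assoc δ ⟩
  δ + δ + δ + δ     ∎) 4δ≤1
  where
  open ≤-Reasoning
  assoc : ∀ δ → δ + (δ + δ + δ) ≡ δ + δ + δ + δ
  assoc = solve-∀ ring

x+x≤⇒charge-inequality : ∀ x c S P δ → x + x ≤ c + S + (δ + δ) * P →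
                         (1ℚ - (δ + δ)) * P ≤ c - ((x - ½ * (S + P)) + (x - ½ * (S + P)))
x+x≤⇒charge-inequality x c S P δ h =
  ≤-via-diff _ (trans (diff x c S P δ ½) (trans (cong (gap +_) (*-zeroˡ (S + P))) (+-identityʳ gap))) (0≤q-p h)
  where
  gap = c + S + (δ + δ) * P - (x + x)
  diff : ∀ x c S P δ t → (c - ((x - t * (S + P)) + (x - t * (S + P)))) - (1ℚ - (δ + δ)) * P
                         ≡ (c + S + (δ + δ) * P - (x + x)) + ((t + t) - 1ℚ) * (S + P)
  diff = solve-∀ ring

x+x≤-of-≤δS : ∀ {x c S P δ} → 0ℚ ≤ c → 0ℚ ≤ S → 0ℚ ≤ P → 0ℚ ≤ δ → δ + δ + δ + δ ≤ 1ℚ →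
              x ≤ δ * S → x + x ≤ c + S + (δ + δ) * P
x+x≤-of-≤δS {x} {c} {S} {P} {δ} 0≤c 0≤S 0≤P 0≤δ 4δ≤1 x≤δS = ≤-via-diff _ (diff x c S P δ)
  (+-mono-≤ (+-mono-≤ (+-mono-≤ 0≤c (0≤* (+-mono-≤ (0≤q-p 4δ≤1) 0≤2δ) 0≤S)) (+-mono-≤ gap gap)) (0≤* 0≤2δ 0≤P))
  where
  0≤2δ = +-mono-≤ 0≤δ 0≤δ
  gap = 0≤q-p x≤δS
  diff : ∀ x c S P δ → c + S + (δ + δ) * P - (x + x)
                       ≡ c + ((1ℚ - (δ + δ + δ + δ)) + (δ + δ)) * S + ((δ * S - x) + (δ * S - x)) + (δ + δ) * P
  diff = solve-∀ ring

x+x≤-of-≤δP : ∀ {x c S P δ} → 0ℚ ≤ c → 0ℚ ≤ S → x ≤ δ * P → x + x ≤ c + S + (δ + δ) * P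
x+x≤-of-≤δP {x} {c} {S} {P} {δ} 0≤c 0≤S x≤δP =
  ≤-via-diff _ (diff x c S P δ) (+-mono-≤ (+-mono-≤ 0≤c 0≤S) (+-mono-≤ (0≤q-p x≤δP) (0≤q-p x≤δP)))
  where
  diff : ∀ x c S P δ → c + S + (δ + δ) * P - (x + x) ≡ c + S + ((δ * P - x) + (δ * P - x))
  diff = solve-∀ ring

-- (c + S + 2δP − 2x) w₁ = ((x − w₁)² + 2δPw₁ − T) + (w₁S − H)
x+x≤-of-contribution : ∀ {x c S P δ w₁ H T} → Positive w₁ → c * w₁ ≡ x * x - (H + T) + w₁ * w₁ →
                       H ≤ w₁ * S → T ≤ (x - w₁) * (x - w₁) + (δ + δ) * P * w₁ →
                       x + x ≤ c + S + (δ + δ) * P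
x+x≤-of-contribution {x} {c} {S} {P} {δ} {w₁} {H} {T} w₁>0 cw₁≡ H≤ T≤ =
  ≤-via-diff D refl (*-cancelʳ-≤-pos w₁ {{w₁>0}} (begin
    0ℚ * w₁                                                             ≡⟨ *-zeroˡ w₁ ⟩
    0ℚ                                                                  ≤⟨ +-mono-≤ (0≤q-p T≤) (0≤q-p H≤) ⟩
    ((x - w₁) * (x - w₁) + (δ + δ) * P * w₁ - T) + (w₁ * S - H)         ≡⟨ regroup x S P δ w₁ H T ⟨
    (x * x - (H + T) + w₁ * w₁) + (S * w₁ + (δ + δ) * P * w₁ - (x + x) * w₁)
                                                                        ≡⟨ cong (_+ (S * w₁ + (δ + δ) * P * w₁ - (x + x) * w₁)) cw₁≡ ⟨
    c * w₁ + (S * w₁ + (δ + δ) * P * w₁ - (x + x) * w₁)                 ≡⟨ expand x c S P δ w₁ ⟨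
    D * w₁                                                              ∎))
  where
  open ≤-Reasoning
  D = c + S + (δ + δ) * P - (x + x)
  expand : ∀ x c S P δ w₁ → (c + S + (δ + δ) * P - (x + x)) * w₁
                            ≡ c * w₁ + (S * w₁ + (δ + δ) * P * w₁ - (x + x) * w₁)
  expand = solve-∀ ring
  regroup : ∀ x S P δ w₁ H T → (x * x - (H + T) + w₁ * w₁) + (S * w₁ + (δ + δ) * P * w₁ - (x + x) * w₁)
                               ≡ ((x - w₁) * (x - w₁) + (δ + δ) * P * w₁ - T) + (w₁ * S - H)
  regroup = solve-∀ ring

tail≤-of-x≤w₁+w₁ : ∀ {x w₁ P δ T} → x ≤ w₁ + w₁ → T ≤ δ * δ * x * P →
                   0ℚ ≤ P → 0ℚ ≤ x → 0ℚ ≤ δ → δ ≤ 1ℚ →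
                   T ≤ (x - w₁) * (x - w₁) + (δ + δ) * P * w₁
tail≤-of-x≤w₁+w₁ {x} {w₁} {P} {δ} x≤2w₁ T≤ 0≤P 0≤x 0≤δ δ≤1 = ≤-trans T≤ (≤-via-diff _ (diff x w₁ P δ)
  (+-mono-≤ (0≤sq (x - w₁)) (0≤* (0≤* 0≤δ 0≤P) (0≤q-p (≤-trans δx≤x x≤2w₁)))))
  where
  diff : ∀ x w₁ P δ → (x - w₁) * (x - w₁) + (δ + δ) * P * w₁ - δ * δ * x * P
                      ≡ (x - w₁) * (x - w₁) + (δ * P) * ((w₁ + w₁) - δ * x)
  diff = solve-∀ ring
  x-δx : ∀ x δ → x - δ * x ≡ (1ℚ - δ) * x
  x-δx = solve-∀ ring
  δx≤x : δ * x ≤ x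
  δx≤x = ≤-via-diff _ (x-δx x δ) (0≤* (0≤q-p δ≤1) 0≤x)

δx²≤-of-w₁+w₁≤x : ∀ {x w₁ δ} → w₁ + w₁ ≤ x → 0ℚ ≤ w₁ → δ + δ + δ + δ ≤ 1ℚ →
                  δ * (x * x) ≤ (x - w₁) * (x - w₁)
δx²≤-of-w₁+w₁≤x {x} {w₁} {δ} 2w₁≤x 0≤w₁ 4δ≤1 =
  ≤-via-diff gap refl (0≤-of-four gap (subst (0ℚ ≤_) (sym (four-gap x w₁ δ))
  (+-mono-≤ (0≤* (0≤q-p 4δ≤1) (0≤sq x))
            (+-mono-≤ (+-mono-≤ (+-mono-≤ (0≤sq y) (0≤sq y)) (0≤sq y))
                      (+-mono-≤ (+-mono-≤ (+-mono-≤ yw₁≥0 yw₁≥0) yw₁≥0) yw₁≥0)))))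
  where
  gap = (x - w₁) * (x - w₁) - δ * (x * x)
  y = x - (w₁ + w₁)
  yw₁≥0 = 0≤* (0≤q-p 2w₁≤x) 0≤w₁
  four-gap : ∀ x w₁ δ → let gap = (x - w₁) * (x - w₁) - δ * (x * x) ; y = x - (w₁ + w₁) in
             gap + gap + gap + gap ≡ (1ℚ - (δ + δ + δ + δ)) * (x * x)
                                     + ((y * y + y * y + y * y) + (y * w₁ + y * w₁ + y * w₁ + y * w₁))
  four-gap = solve-∀ ring

tail≤ : ∀ {x w₁ P δ T} → T ≤ δ * (x * x) → T ≤ δ * δ * x * P →
        0ℚ ≤ P → 0ℚ ≤ x → 0ℚ ≤ w₁ → 0ℚ ≤ δ →
        δ + δ + δ + δ ≤ 1ℚ → T ≤ (x - w₁) * (x - w₁) + (δ + δ) * P * w₁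
tail≤ {x} {w₁} {P} {δ} {T} T≤δx² T≤δ²xP 0≤P 0≤x 0≤w₁ 0≤δ 4δ≤1 with x ≤? w₁ + w₁
... | yes x≤2w₁ = tail≤-of-x≤w₁+w₁ x≤2w₁ T≤δ²xP 0≤P 0≤x 0≤δ (δ≤1-of-four 0≤δ 4δ≤1)
... | no  x≰2w₁ = begin
  T                                                   ≤⟨ T≤δx² ⟩
  δ * (x * x)                                         ≤⟨ δx²≤-of-w₁+w₁≤x {δ = δ} (<⇒≤ (≰⇒> x≰2w₁)) 0≤w₁ 4δ≤1 ⟩
  (x - w₁) * (x - w₁)                                 ≡⟨ +-identityʳ _ ⟨
  (x - w₁) * (x - w₁) + 0ℚ                            ≤⟨ +-monoʳ-≤ ((x - w₁) * (x - w₁))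
                                                                   (0≤* (0≤* (+-mono-≤ 0≤δ 0≤δ) 0≤P) 0≤w₁) ⟩
  (x - w₁) * (x - w₁) + (δ + δ) * P * w₁              ∎
  where open ≤-Reasoning

≤δ*-of-count : ∀ {x S δ N} → 0ℚ ≤ x → 0ℚ ≤ δ → 1ℚ ≤ δ * δ * δ * N → N * (δ * δ * x) ≤ S → x ≤ δ * S
≤δ*-of-count {x} {S} {δ} {N} 0≤x 0≤δ 1≤δ³N N*δ²x≤S = begin
  x                      ≡⟨ *-identityˡ x ⟨
  1ℚ * x                 ≤⟨ *-monoʳ-≤-nonNeg x {{nonNegative 0≤x}} 1≤δ³N ⟩
  δ * δ * δ * N * x      ≡⟨ regroup δ N x ⟩
  δ * (N * (δ * δ * x))  ≤⟨ *-monoˡ-≤-nonNeg δ {{nonNegative 0≤δ}} N*δ²x≤S ⟩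
  δ * S                  ∎
  where
  open ≤-Reasoning
  regroup : ∀ δ N x → δ * δ * δ * N * x ≡ δ * (N * (δ * δ * x))
  regroup = solve-∀ ring

≤δ*-of-light-elements : ∀ {x δ T P} → 0ℚ < x → 0ℚ < δ → T ≤ δ * δ * x * P → δ * (x * x) < T → x ≤ δ * P
≤δ*-of-light-elements {x} {δ} {T} {P} 0<x 0<δ T≤ δx²<T =
  <⇒≤ (*-cancelˡ-<-nonNeg (δ * x) {{nonNegative (0≤* (<⇒≤ 0<δ) (<⇒≤ 0<x))}}
       (subst₂ _<_ (lhs δ x) (rhs δ x P) (<-≤-trans δx²<T T≤)))
  where
  lhs : ∀ δ x → δ * (x * x) ≡ δ * x * x
  lhs = solve-∀ ring
  rhs : ∀ δ x P → δ * δ * x * P ≡ δ * x * (δ * P)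
  rhs = solve-∀ ring

≤δ*-of-heavy-element : ∀ {x δ α b P} → 0ℚ ≤ x → 0ℚ ≤ δ → 1ℚ ≤ δ * α → α * x < b → b ≤ P → x ≤ δ * P
≤δ*-of-heavy-element {x} {δ} {α} {b} {P} 0≤x 0≤δ 1≤δα αx<b b≤P = begin
  x              ≡⟨ *-identityˡ x ⟨
  1ℚ * x         ≤⟨ *-monoʳ-≤-nonNeg x {{nonNegative 0≤x}} 1≤δα ⟩
  δ * α * x      ≡⟨ *-assoc δ α x ⟩
  δ * (α * x)    ≤⟨ *-monoˡ-≤-nonNeg δ {{nonNegative 0≤δ}} (≤-trans (<⇒≤ αx<b) b≤P) ⟩
  δ * P          ∎
  where open ≤-Reasoning

sq≰δ*sq : ∀ {x δ Q} → 0ℚ < x → δ < 1ℚ → x * x ≤ Q → Q ≤ δ * (x * x) → ⊥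
sq≰δ*sq {x} {δ} {Q} 0<x δ<1 x²≤Q Q≤δx² = <-irrefl refl (begin-strict
  x * x          ≤⟨ ≤-trans x²≤Q Q≤δx² ⟩
  δ * (x * x)    <⟨ *-monoˡ-<-pos (x * x) {{positive (0<sq 0<x)}} δ<1 ⟩
  1ℚ * (x * x)   ≡⟨ *-identityˡ (x * x) ⟩
  x * x          ∎)
  where open ≤-Reasoning

-- Natural numbers as rationals, and the ceiling

fromℕ : ℕ → ℚ
fromℕ zero    = 0ℚ
fromℕ (suc k) = 1ℚ + fromℕ k

fromℕ-suc-* : ∀ {k c y Y} → c ≤ y → fromℕ k * c ≤ Y → fromℕ (suc k) * c ≤ y + Y
fromℕ-suc-* {k} {c} c≤y kc≤Y = begin
  fromℕ (suc k) * c     ≡⟨ *-distribʳ-+ c 1ℚ (fromℕ k) ⟩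
  1ℚ * c + fromℕ k * c  ≤⟨ +-mono-≤ (≤-trans (≤-reflexive (*-identityˡ c)) c≤y) kc≤Y ⟩
  _                     ∎
  where open ≤-Reasoning

toℚᵘ-fromℕ : ∀ k → toℚᵘ (fromℕ k) ℚᵘ.≃ ℚᵘ.mkℚᵘ (ℤ.+ k) 0
toℚᵘ-fromℕ zero    = ℚᵘ.*≡* refl
toℚᵘ-fromℕ (suc k) = ℚᵘ.≃-trans (toℚᵘ-homo-+ 1ℚ (fromℕ k))
  (ℚᵘ.≃-trans (ℚᵘ.+-congʳ (toℚᵘ 1ℚ) (toℚᵘ-fromℕ k)) (ℚᵘ.*≡* (cross-multiplied (ℤ.+ k))))
  where
  cross-multiplied : ∀ t → (ℤ.+ 1 ℤ.* ℤ.+ 1 ℤ.+ t ℤ.* ℤ.+ 1) ℤ.* ℤ.+ 1 ≡ (ℤ.+ 1 ℤ.+ t) ℤ.* (ℤ.+ 1 ℤ.* ℤ.+ 1)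
  cross-multiplied = ℤ.solve-∀

-- ceiling q is −⌊−num/den⌋, so [n/d]*d≤n gives num ≤ ceiling q · den.
≤-fromℕ-∣ceiling∣ : ∀ q .{{_ : Positive q}} → q ≤ fromℕ ℤ.∣ ceiling q ∣
≤-fromℕ-∣ceiling∣ (mkℚ ℤ.+[1+ a ] d _) =
  toℚᵘ-cancel-≤ (ℚᵘ.≤-respʳ-≃ (ℚᵘ.≃-sym (toℚᵘ-fromℕ ℤ.∣ c ∣)) (ℚᵘ.*≤* num≤c*den))
  where
  den = ℤ.+[1+ d ]
  c = ℤ.- (ℤ.-[1+ a ] ℤ./ den)
  num≤c*den′ : ℤ.+[1+ a ] ℤ.≤ c ℤ.* den
  num≤c*den′ = subst (ℤ.+[1+ a ] ℤ.≤_) (ℤ.neg-distribˡ-* (ℤ.-[1+ a ] ℤ./ den) den)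
                     (ℤ.neg-mono-≤ ([n/d]*d≤n ℤ.-[1+ a ] den))
  0≤c : ℤ.0ℤ ℤ.≤ c
  0≤c = ℤ.*-cancelʳ-≤-pos ℤ.0ℤ c den (ℤ.≤-trans (ℤ.+≤+ z≤n) num≤c*den′)
  num≤c*den : ℤ.+[1+ a ] ℤ.* ℤ.+ 1 ℤ.≤ ℤ.+ ℤ.∣ c ∣ ℤ.* den
  num≤c*den = subst₂ ℤ._≤_ (sym (ℤ.*-identityʳ ℤ.+[1+ a ])) (cong (ℤ._* den) (sym (ℤ.0≤i⇒+∣i∣≡i 0≤c))) num≤c*den′

1≤*fromℕ-∣ceiling-1/∣ : ∀ d .{{_ : Positive d}} → 1ℚ ≤ d * fromℕ ℤ.∣ ceiling ((1/ d) {{pos⇒nonZero d}}) ∣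
1≤*fromℕ-∣ceiling-1/∣ d = begin
  1ℚ                                  ≡⟨ *-inverseʳ d {{pos⇒nonZero d}} ⟨
  d * 1/d                             ≤⟨ *-monoˡ-≤-nonNeg d {{pos⇒nonNeg d}} (≤-fromℕ-∣ceiling∣ 1/d {{1/pos⇒pos d}}) ⟩
  d * fromℕ ℤ.∣ ceiling 1/d ∣         ∎
  where
  open ≤-Reasoning
  1/d = (1/ d) {{pos⇒nonZero d}}

-- No `with` below: with-abstraction normalises the goal, and normalising the rational
-- expressions α, δ and m (open in σ) is prohibitively slow.  Boolean case splits use Bool-elim.
module Analysis (n : ℕ) (adj : Fin n → Fin n → Bool) (w : Fin n → ℚ) (wpos : ∀ i → Positive (w i))
         (A : Subset n) (σ : ℚ) (σpos : Positive σ) (ord : Fin n → List (Fin n)) where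

  open Setting n adj w wpos A σ σpos ord

  w² : Fin n → ℚ
  w² a = w a * w a

  0≤w : ∀ a → 0ℚ ≤ w a
  0≤w a = <⇒≤ (positive⁻¹ (w a) {{wpos a}})

  Descending : List (Fin n) → Set
  Descending = AllPairs (λ a b → w b ≤ w a)

  Descending-bounded : ∀ {b T M} → Descending (b ∷ T) → w b ≤ M → All (λ a → w a ≤ M) (b ∷ T)
  Descending-bounded (b≥T ∷ _) b≤M = b≤M ∷ All.map (λ a≤b → ≤-trans a≤b b≤M) b≥T

  δ-positive : Positive δ
  δ-positive = pos*pos⇒pos σ {{σpos}} (ℤ.+ 1 / 4)

  0<δ : 0ℚ < δ
  0<δ = positive⁻¹ δ {{δ-positive}}

  0≤δ : 0ℚ ≤ δ
  0≤δ = <⇒≤ 0<δ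

  δ²-positive : Positive (δ * δ)
  δ²-positive = pos*pos⇒pos δ {{δ-positive}} δ {{δ-positive}}

  δ²-nonZero : NonZero (δ * δ)
  δ²-nonZero = pos⇒nonZero (δ * δ) {{δ²-positive}}

  module _ (σ<1 : σ < 1ℚ) where

    4δ≤1 : δ + δ + δ + δ ≤ 1ℚ
    4δ≤1 = <⇒≤ (subst (_< 1ℚ) (trans (sym (*-identityʳ σ)) (distrib σ (ℤ.+ 1 / 4))) σ<1)
      where
      distrib : ∀ s q → s * (q + q + q + q) ≡ s * q + s * q + s * q + s * q
      distrib = solve-∀ ring

    1≤δα : 1ℚ ≤ δ * α
    1≤δα = begin
      1ℚ               ≡⟨ *-inverseˡ (δ * δ) {{δ²-nonZero}} ⟨
      α * (δ * δ)      ≡⟨ regroup α δ ⟩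
      δ * α * δ        ≤⟨ *-monoˡ-≤-nonNeg (δ * α) {{nonNegative 0≤δα}} (δ≤1-of-four 0≤δ 4δ≤1) ⟩
      δ * α * 1ℚ       ≡⟨ *-identityʳ (δ * α) ⟩
      δ * α            ∎
      where
      open ≤-Reasoning
      0≤δα = 0≤* 0≤δ (<⇒≤ (positive⁻¹ α {{1/pos⇒pos (δ * δ) {{δ²-positive}}}}))
      regroup : ∀ α δ → α * (δ * δ) ≡ δ * α * δ
      regroup = solve-∀ ring

  α⁻¹≡δ² : α⁻¹ ≡ δ * δ
  α⁻¹≡δ² = 1/-involutive (δ * δ) {{δ²-nonZero}}

  1≤δ³m : 1ℚ ≤ δ * δ * δ * fromℕ m
  1≤δ³m = 1≤*fromℕ-∣ceiling-1/∣ (δ * δ * δ) {{pos*pos⇒pos (δ * δ) {{δ²-positive}} δ {{δ-positive}}}}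

  tailLight : Fin n → List (Fin n) → Bool
  tailLight u L = Σˡ w² (drop (prefixLen u L ⊓ m) L) ≤ᵇ β * (w u * w u)

  -- help u is take (helpLen u (ord u)) (ord u), up to if-take.
  helpLen : Fin n → List (Fin n) → ℕ
  helpLen u L = if tailLight u L then prefixLen u L ⊓ m else 0

  -- With c = contr(u, n₁(u)) and k = |help(u)| this is the claim in the form 2x ≤ c + S + 2δP.
  Covers : Fin n → List (Fin n) → ℚ → ℕ → Set
  Covers u L c k = w u + w u ≤ c + Σˡ w (take k L) + (δ + δ) * Σˡ w (drop k L)

  Covers-mono : ∀ {u L c c′ k} → c ≤ c′ → Covers u L c k → Covers u L c′ k
  Covers-mono {L = L} {k = k} c≤c′ covers =
    ≤-trans covers (+-monoˡ-≤ ((δ + δ) * Σˡ w (drop k L)) (+-monoˡ-≤ (Σˡ w (take k L)) c≤c′))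

  module _ (u : Fin n) where

    inRange-bounds : ∀ {a} → inRange u a ≡ true → δ * δ * w u ≤ w a × w a ≤ α * w u
    inRange-bounds {a} r = subst (λ t → t * w u ≤ w a) α⁻¹≡δ² (≤ᵇ⇒≤ (proj₁ bounds)) , ≤ᵇ⇒≤ (proj₂ bounds)
      where bounds = Equivalence.to T-∧ (Equivalence.from T-≡ r)

    outOfRange : ∀ {a} → inRange u a ≡ false → w a < δ * δ * w u ⊎ α * w u < w a
    outOfRange {a} r =
      Sum.map₁ (subst (λ t → w a < t * w u) α⁻¹≡δ²) (≤ᵇ-∧-false {α⁻¹ * w u} {w a} {w a} {α * w u} r)

    prefix-sum≥ : ∀ k L → k ≤ℕ prefixLen u L → fromℕ k * (δ * δ * w u) ≤ Σˡ w (take k L)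
    prefix-sum≥ zero    L       _ = ≤-reflexive (*-zeroˡ (δ * δ * w u))
    prefix-sum≥ (suc k) (a ∷ L)   = Bool-elim
      (λ t → suc k ≤ℕ (if t then suc (prefixLen u L) else 0) → fromℕ (suc k) * (δ * δ * w u) ≤ w a + Σˡ w (take k L))
      (inRange u a)
      (λ { r (s≤s k≤p) → fromℕ-suc-* {k} (proj₁ (inRange-bounds r)) (prefix-sum≥ k L k≤p) })
      (λ { _ () })

    prefix-maximal : ∀ L {b T′} → drop (prefixLen u L) L ≡ b ∷ T′ → inRange u b ≡ false
    prefix-maximal (a ∷ L) {b} {T′} = Bool-elim
      (λ t → drop (if t then suc (prefixLen u L) else 0) (a ∷ L) ≡ b ∷ T′ → inRange u b ≡ false) (inRange u a)
      (λ _ → prefix-maximal L)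
      (λ { r refl → r })

    tailLight⇒ : ∀ L → tailLight u L ≡ true → Σˡ w² (drop (prefixLen u L ⊓ m) L) ≤ δ * (w u * w u)
    tailLight⇒ L t = ≤ᵇ⇒≤ (Equivalence.from T-≡ t)

    ¬tailLight⇒ : ∀ L → tailLight u L ≡ false → ¬ (Σˡ w² (drop (prefixLen u L ⊓ m) L) ≤ δ * (w u * w u))
    ¬tailLight⇒ L t tail≤ = subst T t (≤⇒≤ᵇ tail≤)

    heavy-of-long-prefix : ∀ L → m ≤ℕ prefixLen u L → w u ≤ δ * Σˡ w (take m L)
    heavy-of-long-prefix L m≤p = ≤δ*-of-count (0≤w u) 0≤δ 1≤δ³m (prefix-sum≥ m L m≤p)

    module _ (σ<1 : σ < 1ℚ) where

      heavy-of-heavy-tail : ∀ {b T′} → Descending (b ∷ T′) → inRange u b ≡ false →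
                            ¬ (Σˡ w² (b ∷ T′) ≤ δ * (w u * w u)) → w u ≤ δ * Σˡ w (b ∷ T′)
      heavy-of-heavy-tail {b} {T′} desc r heavy = Sum.[ below , above ] (outOfRange r)
        where
        below : w b < δ * δ * w u → w u ≤ δ * Σˡ w (b ∷ T′)
        below b<δ²x = ≤δ*-of-light-elements (positive⁻¹ (w u) {{wpos u}}) 0<δ
          (Σˡ-squares≤ w 0≤w (b ∷ T′) (Descending-bounded desc (<⇒≤ b<δ²x))) (≰⇒> heavy)
        above : α * w u < w b → w u ≤ δ * Σˡ w (b ∷ T′)
        above αx<b = ≤δ*-of-heavy-element (0≤w u) 0≤δ (1≤δα σ<1) αx<b (Σˡ-head≤ w 0≤w b T′)

      heavy-without-help : ∀ L → Descending L → tailLight u L ≡ false → w u ≤ δ * Σˡ w L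
      heavy-without-help L desc t = by-length (m ℕ.≤? prefixLen u L)
        where
        p = prefixLen u L
        δ*-mono = *-monoˡ-≤-nonNeg δ {{nonNegative 0≤δ}}
        by-tail : ¬ (Σˡ w² (drop p L) ≤ δ * (w u * w u)) → ∀ T → drop p L ≡ T → w u ≤ δ * Σˡ w L
        by-tail heavy []       drop≡ = ⊥-elim (heavy (subst (λ T → Σˡ w² T ≤ δ * (w u * w u)) (sym drop≡)
                                                          (0≤* 0≤δ (0≤sq (w u)))))
        by-tail heavy (b ∷ T′) drop≡ = ≤-trans
          (heavy-of-heavy-tail (subst Descending drop≡ (AllPairs.drop⁺ p desc)) (prefix-maximal L drop≡)
                               (subst (λ T → ¬ (Σˡ w² T ≤ δ * (w u * w u))) drop≡ heavy))
          (δ*-mono (subst (λ T → Σˡ w T ≤ Σˡ w L) drop≡ (Σˡ-drop≤ w 0≤w p L)))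
        by-length : Dec (m ≤ℕ p) → w u ≤ δ * Σˡ w L
        by-length (yes m≤p) = ≤-trans (heavy-of-long-prefix L m≤p) (δ*-mono (Σˡ-take≤ w 0≤w m L))
        by-length (no  m≰p) = by-tail
          (subst (λ k → ¬ (Σˡ w² (drop k L) ≤ δ * (w u * w u))) (ℕ.m≤n⇒m⊓n≡m (ℕ.<⇒≤ (ℕ.≰⇒> m≰p)))
                 (¬tailLight⇒ L t))
          (drop p L) refl

      tail-below-range : ∀ {v₁ L′} → Descending (v₁ ∷ L′) → inRange u v₁ ≡ true →
                         All (λ a → w a ≤ δ * δ * w u) (drop (prefixLen u L′) L′)
      tail-below-range {v₁} {L′} (L′≤v₁ ∷ desc) r = tail-cases (drop p′ L′) refl
        where
        p′ = prefixLen u L′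
        tail-cases : ∀ T → drop p′ L′ ≡ T → All (λ a → w a ≤ δ * δ * w u) T
        tail-cases []       _     = []
        tail-cases (b ∷ T′) drop≡ = Sum.[ below , (λ αx<b → ⊥-elim (<-irrefl refl (<-≤-trans αx<b b≤αx))) ]
                                       (outOfRange (prefix-maximal L′ drop≡))
          where
          b≤αx : w b ≤ α * w u
          b≤αx = ≤-trans (All.head (subst (All (λ a → w a ≤ w v₁)) drop≡ (All.drop⁺ p′ L′≤v₁)))
                         (proj₂ (inRange-bounds r))
          below : w b < δ * δ * w u → All (λ a → w a ≤ δ * δ * w u) (b ∷ T′)
          below b<δ²x = Descending-bounded (subst Descending drop≡ (AllPairs.drop⁺ p′ desc)) (<⇒≤ b<δ²x)

      covers-of-full-prefix : ∀ {v₁ L′ c} → Descending (v₁ ∷ L′) → inRange u v₁ ≡ true →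
                              Σˡ w² (drop (prefixLen u L′) L′) ≤ δ * (w u * w u) →
                              c * w v₁ ≡ w u * w u - Σˡ w² L′ →
                              Covers u (v₁ ∷ L′) c (suc (prefixLen u L′))
      covers-of-full-prefix {v₁} {L′} {c} desc@(L′≤v₁ ∷ _) r tail≤δx² cw₁≡ =
        x+x≤-of-contribution {w u} {c} {Σˡ w (v₁ ∷ take p′ L′)} {Σˡ w (drop p′ L′)} {δ} {w v₁}
                             (wpos v₁) cw₁≡′ head≤
          (tail≤ tail≤δx² (Σˡ-squares≤ w 0≤w (drop p′ L′) (tail-below-range desc r))
                 (Σˡ-nonNeg w 0≤w (drop p′ L′)) (0≤w u) (0≤w v₁) 0≤δ (4δ≤1 σ<1))
        where
        p′ = prefixLen u L′
        regroup : ∀ x² w₁² H T → x² - (H + T) ≡ x² - ((w₁² + H) + T) + w₁²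
        regroup = solve-∀ ring
        cw₁≡′ : c * w v₁ ≡ w u * w u - (Σˡ w² (v₁ ∷ take p′ L′) + Σˡ w² (drop p′ L′)) + w v₁ * w v₁
        cw₁≡′ = trans cw₁≡ (trans (cong (λ t → w u * w u - t) (Σˡ-take-drop w² p′ L′))
                                  (regroup (w u * w u) (w v₁ * w v₁) (Σˡ w² (take p′ L′)) (Σˡ w² (drop p′ L′))))
        head≤ : Σˡ w² (v₁ ∷ take p′ L′) ≤ w v₁ * Σˡ w (v₁ ∷ take p′ L′)
        head≤ = Σˡ-squares≤ w 0≤w (v₁ ∷ take p′ L′) (≤-refl ∷ All.take⁺ p′ L′≤v₁)

      covers-helpLen : ∀ {v₁ L′ c} → Descending (v₁ ∷ L′) → w u * w u ≤ Σˡ w² (v₁ ∷ L′) →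
                       c * w v₁ ≡ w u * w u - Σˡ w² L′ → Covers u (v₁ ∷ L′) (0ℚ ⊔ c) (helpLen u (v₁ ∷ L′))
      covers-helpLen {v₁} {L′} {c} desc x²≤ cw₁≡ =
        Bool-elim (λ t → Covers u L c′ (if t then j else 0)) (tailLight u L) with-help without-help
        where
        L = v₁ ∷ L′
        c′ = 0ℚ ⊔ c
        p = prefixLen u L
        j = p ⊓ m
        0≤c′ = p≤p⊔q 0ℚ c

        without-help : tailLight u L ≡ false → Covers u L c′ 0
        without-help t = x+x≤-of-≤δP {P = Σˡ w L} {δ} 0≤c′ ≤-refl (heavy-without-help L desc t)

        by-head : tailLight u L ≡ true → ¬ (m ≤ℕ p) → Covers u L c′ j
        by-head t m≰p = Bool-elim (λ _ → Covers u L c′ j) (inRange u v₁) in-range out-of-range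
          where
          tail-light = tailLight⇒ L t
          in-range : inRange u v₁ ≡ true → Covers u L c′ j
          in-range r = subst (Covers u L c′) (sym j≡)
            (Covers-mono {L = L} {c} {k = suc (prefixLen u L′)} (p≤q⊔p 0ℚ c) (covers-of-full-prefix {c = c} desc r
              (subst (λ k → Σˡ w² (drop k L) ≤ δ * (w u * w u)) j≡ tail-light) cw₁≡))
            where
            p≡ : p ≡ suc (prefixLen u L′)
            p≡ = cong (λ t → if t then suc (prefixLen u L′) else 0) r
            j≡ : j ≡ suc (prefixLen u L′)
            j≡ = trans (cong (_⊓ m) p≡) (ℕ.m≤n⇒m⊓n≡m (subst (_≤ℕ m) p≡ (ℕ.<⇒≤ (ℕ.≰⇒> m≰p))))
          out-of-range : inRange u v₁ ≡ false → Covers u L c′ j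
          out-of-range r = ⊥-elim (sq≰δ*sq (positive⁻¹ (w u) {{wpos u}}) (δ<1-of-four 0<δ (4δ≤1 σ<1)) x²≤
            (subst (λ k → Σˡ w² (drop k L) ≤ δ * (w u * w u)) j≡0 tail-light))
            where
            j≡0 : j ≡ 0
            j≡0 = cong (λ t → (if t then suc (prefixLen u L′) else 0) ⊓ m) r

        by-length : tailLight u L ≡ true → Dec (m ≤ℕ p) → Covers u L c′ j
        by-length _ (yes m≤p) = subst (Covers u L c′) (sym (ℕ.m≥n⇒m⊓n≡n m≤p))
          (x+x≤-of-≤δS 0≤c′ (Σˡ-nonNeg w 0≤w (take m L)) (Σˡ-nonNeg w 0≤w (drop m L)) 0≤δ (4δ≤1 σ<1)
                       (heavy-of-long-prefix L m≤p))
        by-length t (no m≰p) = by-head t m≰p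

        with-help : tailLight u L ≡ true → Covers u L c′ j
        with-help t = by-length t (m ℕ.≤? p)

  wt2-⁅⁆ : ∀ u → wt2 ⁅ u ⁆ ≡ w u * w u
  wt2-⁅⁆ u = trans (Σᶠ-cong n (λ i → cong (λ b → if b then w² i else 0ℚ) (lookup-⁅⁆ u i))) (Σᶠ-indicator n w² u)

  ⁅⁆-independent : Irreflexive → ∀ u → Independent ⁅ u ⁆
  ⁅⁆-independent irrefl u x y x∈ y∈ =
    subst₂ (λ a b → adj a b ≡ false) (sym (x∈⁅y⁆⇒x≡y u x∈)) (sym (x∈⁅y⁆⇒x≡y u y∈)) (irrefl u)

  sq≤wt2-Nu : Irreflexive → NoClawShapedImprovement → ∀ u → ClawShaped ⁅ u ⁆ → w u * w u ≤ wt2 (Nu u)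
  sq≤wt2-Nu irrefl noClaw u shaped = ≮⇒≥ λ wt2<x² →
    noClaw ⁅ u ⁆ shaped (⁅⁆-independent irrefl u , subst (wt2 (Nu u) <_) (sym (wt2-⁅⁆ u)) wt2<x²)

  Nu-member : ∀ {u v} → v ∈ Nu u →
              lookup A v ≡ true × (lookup ⁅ u ⁆ v ∨ anyᶠ n (λ x → lookup ⁅ u ⁆ x ∧ adj x v)) ≡ true
  Nu-member {u} {v} v∈Nu = ∧-true⁻ (trans (sym (lookup∘tabulate _ v)) ([]=⇒lookup v∈Nu))

  Nu⊆A : ∀ {u v} → v ∈ Nu u → v ∈ A
  Nu⊆A {u} {v} v∈Nu = lookup⇒[]= v A (proj₁ (Nu-member {u} v∈Nu))

  Nu-adjacent : ∀ {u v} → u ∉ A → v ∈ Nu u → adj u v ≡ true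
  Nu-adjacent {u} {v} u∉A v∈Nu = Sum.[ itself , via-neighbour ] (∨-true⁻ (proj₂ (Nu-member {u} v∈Nu)))
    where
    itself : lookup ⁅ u ⁆ v ≡ true → adj u v ≡ true
    itself v∈u = ⊥-elim (u∉A (subst (_∈ A) (x∈⁅y⁆⇒x≡y u (lookup⇒[]= v ⁅ u ⁆ v∈u)) (Nu⊆A {u} v∈Nu)))
    via-neighbour : anyᶠ n (λ x → lookup ⁅ u ⁆ x ∧ adj x v) ≡ true → adj u v ≡ true
    via-neighbour any≡true =
      subst (λ z → adj z v ≡ true) (x∈⁅y⁆⇒x≡y u (lookup⇒[]= x ⁅ u ⁆ (proj₁ x∈u∧xv))) (proj₂ x∈u∧xv)
      where
      witness = anyᶠ-true⁻ n _ any≡true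
      x = proj₁ witness
      x∈u∧xv = ∧-true⁻ (proj₂ witness)

  module _ (valid : ValidOrder) (u : Fin n) where

    ord⇔Nu : ∀ a → (a List.∈ ord u) ⇔ (a ∈ Nu u)
    ord⇔Nu = proj₁ (proj₂ (valid u))

    ord-unique : Unique (ord u)
    ord-unique = proj₁ (valid u)

    ord-descending : Descending (ord u)
    ord-descending = Linked⇒AllPairs (λ b≤a c≤b → ≤-trans c≤b b≤a) (proj₂ (proj₂ (valid u)))

    Nu≡ord : ∀ i → lookup (Nu u) i ≡ memB i (ord u)
    Nu≡ord i = ≡-from-true⇔true
      (λ i∈Nu → ∈⇒memB (Equivalence.from (ord⇔Nu i) (lookup⇒[]= i (Nu u) i∈Nu)))
      (λ i∈ord → []=⇒lookup (Equivalence.to (ord⇔Nu i) (memB⇒∈ (ord u) i∈ord)))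

    wt-Nu : wt (Nu u) ≡ Σˡ w (ord u)
    wt-Nu = Σᶠ-subset n w (Nu u) (ord u) Nu≡ord ord-unique

    wt2-Nu : wt2 (Nu u) ≡ Σˡ w² (ord u)
    wt2-Nu = Σᶠ-subset n w² (Nu u) (ord u) Nu≡ord ord-unique

    supp≡drop : ∀ i → lookup (supp u) i ≡ memB i (drop (helpLen u (ord u)) (ord u))
    supp≡drop i = begin
      lookup (supp u) i                                 ≡⟨ lookup∘tabulate _ i ⟩
      lookup (Nu u) i ∧ not (memB i (help u))           ≡⟨ cong₂ (λ b h → b ∧ not (memB i h)) (Nu≡ord i)
                                                                  (if-take (tailLight u (ord u)) (iEnd-1 u) (ord u)) ⟩
      memB i (ord u) ∧ not (memB i (take k (ord u)))    ≡⟨ cong (λ L → memB i L ∧ not (memB i (take k (ord u))))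
                                                                (take++drop≡id k (ord u)) ⟨
      memB i (take k (ord u) ++ drop k (ord u)) ∧ not (memB i (take k (ord u)))
                                                        ≡⟨ memB-++-∖ i (take k (ord u)) (drop k (ord u))
                                                             (subst Unique (sym (take++drop≡id k (ord u))) ord-unique) ⟩
      memB i (drop k (ord u))                           ∎
      where
      open ≡-Reasoning
      k = helpLen u (ord u)

    wt-supp : wt (supp u) ≡ Σˡ w (drop (helpLen u (ord u)) (ord u))
    wt-supp = Σᶠ-subset n w (supp u) (drop (helpLen u (ord u)) (ord u)) supp≡drop (Unique.drop⁺ (helpLen u (ord u)) ord-unique)

    singleton-claw-shaped : Symmetric → u ∉ A → ClawShaped ⁅ u ⁆
    singleton-claw-shaped sym-adj u∉A = by-ord (ord u) refl
      where
      by-ord : ∀ L → ord u ≡ L → ClawShaped ⁅ u ⁆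
      by-ord []      ord≡ = inj₁ (∣⁅x⁆∣≡1 u , λ { (v , v∈Nu) → true≢false (trans (sym ([]=⇒lookup v∈Nu))
                                                                   (trans (Nu≡ord v) (cong (memB v) ord≡))) })
        where
        true≢false : true ≢ false
        true≢false ()
      by-ord (v ∷ _) ord≡ = inj₂ (v , Nu⊆A {u} v∈Nu , λ y y∈u →
        subst (λ z → adj v z ≡ true) (sym (x∈⁅y⁆⇒x≡y u y∈u)) (trans (sym-adj v u) (Nu-adjacent u∉A v∈Nu)))
        where
        v∈Nu = Equivalence.to (ord⇔Nu v) (subst (v List.∈_) (sym ord≡) (here refl))

    charge-head : ∀ {v₁ L′} → ord u ≡ v₁ ∷ L′ → charge u v₁ ≡ w u - ½ * wt (Nu u)
    charge-head {v₁} ord≡ with ord u | ord≡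
    ... | _ | refl = cong (λ b → if b then w u - ½ * wt (Nu u) else 0ℚ) (dec-true (v₁ ≟ v₁) refl)

    module _ {v₁ L′} (ord≡ : ord u ≡ v₁ ∷ L′) where

      head∈Nu : v₁ ∈ Nu u
      head∈Nu = Equivalence.to (ord⇔Nu v₁) (subst (v₁ List.∈_) (sym ord≡) (here refl))

      Nu∖head≡L′ : ∀ i → lookup (Nu u ∩ ∁ ⁅ v₁ ⁆) i ≡ memB i L′
      Nu∖head≡L′ i = begin
        lookup (Nu u ∩ ∁ ⁅ v₁ ⁆) i                  ≡⟨ lookup-zipWith _∧_ i (Nu u) (∁ ⁅ v₁ ⁆) ⟩
        lookup (Nu u) i ∧ lookup (∁ ⁅ v₁ ⁆) i       ≡⟨ cong₂ _∧_ (trans (Nu≡ord i) (cong (memB i) ord≡))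
                                                              (trans (lookup-map i not ⁅ v₁ ⁆)
                                                                     (cong not (trans (lookup-⁅⁆ v₁ i) (sym (∨-identityʳ _))))) ⟩
        memB i (v₁ ∷ L′) ∧ not (memB i (v₁ ∷ []))   ≡⟨ memB-++-∖ i (v₁ ∷ []) L′ (subst Unique ord≡ ord-unique) ⟩
        memB i L′                                   ∎
        where open ≡-Reasoning

      wt2-Nu∖head : wt2 (Nu u ∩ ∁ ⁅ v₁ ⁆) ≡ Σˡ w² L′
      wt2-Nu∖head = Σᶠ-subset n w² (Nu u ∩ ∁ ⁅ v₁ ⁆) L′ Nu∖head≡L′ (Unique.drop⁺ 1 (subst Unique ord≡ ord-unique))

      head-contribution : ∃ λ c → c * w v₁ ≡ w u * w u - Σˡ w² L′ × 0ℚ ⊔ c ≤ contrSum u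
      head-contribution = ratio , ratio*w₁≡ , ⊔≤contrSum
        where
        instance
          w₁≢0 : NonZero (w v₁)
          w₁≢0 = pos⇒nonZero (w v₁) {{wpos v₁}}
        gain = w u * w u - wt2 (Nu u ∩ ∁ ⁅ v₁ ⁆)
        ratio = gain ÷ w v₁
        ratio*w₁≡ : ratio * w v₁ ≡ w u * w u - Σˡ w² L′
        ratio*w₁≡ = begin
          gain * 1/ w v₁ * w v₁          ≡⟨ *-assoc gain (1/ w v₁) (w v₁) ⟩
          gain * (1/ w v₁ * w v₁)        ≡⟨ cong (gain *_) (*-inverseˡ (w v₁)) ⟩
          gain * 1ℚ                      ≡⟨ *-identityʳ gain ⟩
          gain                           ≡⟨ cong (λ t → w u * w u - t) wt2-Nu∖head ⟩
          w u * w u - Σˡ w² L′           ∎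
          where open ≡-Reasoning
        0≤contr : ∀ v → 0ℚ ≤ contr u v
        0≤contr v = 0≤if (lookup (Nu u) v)
          (p≤p⊔q 0ℚ (((w u * w u - wt2 (Nu u ∩ ∁ ⁅ v ⁆)) ÷ w v) {{pos⇒nonZero (w v) {{wpos v}}}}))
        contr-head : (if lookup A v₁ then contr u v₁ else 0ℚ) ≡ 0ℚ ⊔ ratio
        contr-head = trans (cong (λ b → if b then contr u v₁ else 0ℚ) ([]=⇒lookup (Nu⊆A {u} head∈Nu)))
                           (cong (λ b → if b then 0ℚ ⊔ ratio else 0ℚ) ([]=⇒lookup head∈Nu))
        ⊔≤contrSum : 0ℚ ⊔ ratio ≤ contrSum u
        ⊔≤contrSum = subst (_≤ contrSum u) contr-head
          (Σᶠ-term≤ n _ (λ v → 0≤if (lookup A v) (0≤contr v)) v₁)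

    supp-inequality : σ < 1ℚ → w u * w u ≤ wt2 (Nu u) → ∀ {v₁ L′} → ord u ≡ v₁ ∷ L′ →
                      (1ℚ - (δ + δ)) * wt (supp u) ≤ contrSum u - (charge u v₁ + charge u v₁)
    supp-inequality σ<1 x²≤ {v₁} {L′} ord≡ = begin
      (1ℚ - (δ + δ)) * wt (supp u)                             ≡⟨ cong ((1ℚ - (δ + δ)) *_) wt-supp ⟩
      (1ℚ - (δ + δ)) * P                                       ≤⟨ x+x≤⇒charge-inequality (w u) c′ S P δ covers ⟩
      c′ - ((w u - ½ * (S + P)) + (w u - ½ * (S + P)))         ≡⟨ cong (λ t → c′ - (t + t)) charge≡ ⟨
      c′ - (charge u v₁ + charge u v₁)                         ≤⟨ +-monoˡ-≤ (- (charge u v₁ + charge u v₁)) c′≤contrSum ⟩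
      contrSum u - (charge u v₁ + charge u v₁)                 ∎
      where
      open ≤-Reasoning
      k = helpLen u (ord u)
      S = Σˡ w (take k (ord u))
      P = Σˡ w (drop k (ord u))
      contribution = head-contribution ord≡
      c′ = 0ℚ ⊔ proj₁ contribution
      c′≤contrSum = proj₂ (proj₂ contribution)
      charge≡ : charge u v₁ ≡ w u - ½ * (S + P)
      charge≡ = trans (charge-head ord≡) (cong (λ t → w u - ½ * t) (trans wt-Nu (Σˡ-take-drop w k (ord u))))
      covers : Covers u (ord u) c′ k
      covers = subst (λ L → Covers u L c′ (helpLen u L)) (sym ord≡)
        (covers-helpLen u σ<1 {c = proj₁ contribution} (subst Descending ord≡ ord-descending)
                        (subst (λ L → w u * w u ≤ Σˡ w² L) ord≡ (subst (w u * w u ≤_) wt2-Nu x²≤))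
                        (proj₁ (proj₂ contribution)))

lemma18 : (k : ℕ) → 3 ≤ℕ k
    → (n : ℕ) (adj : Fin n → Fin n → Bool) (w : Fin n → ℚ) (wpos : ∀ i → Positive (w i))
    → (A* A : Subset n) (σ : ℚ) (σpos : Positive σ) (ord : Fin n → List (Fin n))
    → let open Setting n adj w wpos A σ σpos ord in
    Symmetric → Irreflexive → ClawFree k
    → σ < 1ℚ
    → MaxWeightIndependent A*
    → Independent A
    → NoClawShapedImprovement
    → ValidOrder
    → ∀ u → u ∈ A* → u ∉ A
    → ∃ (λ v → head (ord u) ≡ just v
    × ((1ℚ - (δ + δ)) * wt (supp u) ≤ contrSum u - (charge u v + charge u v)))
lemma18 _ _ n adj w wpos _ A σ σpos ord sym-adj irrefl _ σ<1 _ _ noClaw valid u _ u∉A = by-ord (ord u) refl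
  where
  open Setting n adj w wpos A σ σpos ord
  open Analysis n adj w wpos A σ σpos ord
  x²≤ : w u * w u ≤ wt2 (Nu u)
  x²≤ = sq≤wt2-Nu irrefl noClaw u (singleton-claw-shaped valid u sym-adj u∉A)
  by-ord : ∀ L → ord u ≡ L → ∃ (λ v → head (ord u) ≡ just v
                               × ((1ℚ - (δ + δ)) * wt (supp u) ≤ contrSum u - (charge u v + charge u v)))
  by-ord []        ord≡ = ⊥-elim (<-irrefl refl (<-≤-trans (0<sq (positive⁻¹ (w u) {{wpos u}}))
                                   (subst (w u * w u ≤_) (trans (wt2-Nu valid u) (cong (Σˡ w²) ord≡)) x²≤)))
  by-ord (v₁ ∷ L′) ord≡ = v₁ , cong head ord≡ , supp-inequality valid u σ<1 x²≤ ord≡
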